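{- Let $n$ and $d$ be positive integers, let $\mathcal{T}(d,n)$ be the set of width-one $n\times n$ matrices with nonnegative integer entries summing to $d$, and let $\mathbf{S}(d,n)=\sum_{T\in\mathcal{T}(d,n)} T$. Then for all $1\le i,j\le n$, \[ \mathbf{S}(d,n)_{ij}=\sum_{k=0}^{\min\{d,n\}-1}\binom{2n+d-k-2}{2n-1}\sum_{\ell=0}^{k}\binom{i-1}{\ell}\binom{j-1}{\ell}\binom{n-i}{k-\ell}\binom{n-j}{k-\ell}. \]
   Context: Equip $\Pi_n=\{(x,y):1\le x,y\le n\}$ with the product order $(x,y)\preceq(x',y')$ iff $x\le x'$ and $y\le y'$. The support of an $n\times n$ matrix $M$ is $\{(i,j): M_{ij}\neq 0\}$; $M$ is width-one if its support is a chain in $\Pi_n$ (equivalently, the nonzero entries lie along a path of south and east steps). Binomial coefficients $\binom{a}{b}$ are $0$ when $b<0$ or $b>a\ge 0$. -}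

module Defs where

open import Data.Nat using (ℕ; zero; suc; _+_; _*_; _∸_; _≤_; _⊓_)
open import Data.Nat.Combinatorics using (_C_)
open import Data.Fin using (Fin; toℕ)
open import Data.Vec using (Vec; lookup)
open import Data.List using (List; map; upTo; allFin)
open import Data.Nat.ListAction using (sum)
open import Data.Product using (_×_; Σ; ∃-syntax)
open import Data.Sum using (_⊎_)
open import Relation.Binary.PropositionalEquality using (_≡_; _≢_)

Σ<[_]_ : ℕ → (ℕ → ℕ) → ℕ
Σ<[ m ] f = sum (map f (upTo m))

Matrix : ℕ → Set
Matrix n = Vec (Vec ℕ n) n

entry : ∀ {n} → Matrix n → Fin n → Fin n → ℕ
entry M i j = lookup (lookup M i) j

InSupport : ∀ {n} → Matrix n → Fin n → Fin n → Set
InSupport M i j = entry M i j ≢ 0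

_⪯_ : ∀ {n} → (Fin n × Fin n) → (Fin n × Fin n) → Set
(i Data.Product., j) ⪯ (i' Data.Product., j') = (toℕ i ≤ toℕ i') × (toℕ j ≤ toℕ j')

WidthOne : ∀ {n} → Matrix n → Set
WidthOne {n} M = ∀ (i j i' j' : Fin n) → InSupport M i j → InSupport M i' j' →
  ((i Data.Product., j) ⪯ (i' Data.Product., j')) ⊎ ((i' Data.Product., j') ⪯ (i Data.Product., j))

totalSum : ∀ {n} → Matrix n → ℕ
totalSum {n} M = sum (map (λ i → sum (map (λ j → entry M i j) (allFin n))) (allFin n))

InT : (d n : ℕ) → Matrix n → Set
InT d n M = WidthOne M × (totalSum M ≡ d)

-- the right-hand side, with 1-based indices i = toℕ i₀ + 1, j = toℕ j₀ + 1
formula : (d n i j : ℕ) → ℕ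
formula d n i j =
  Σ<[ d ⊓ n ] (λ k →
    ((2 * n + d ∸ k ∸ 2) C (2 * n ∸ 1)) *
    Σ<[ suc k ] (λ l →
      ((i ∸ 1) C l) * ((j ∸ 1) C l) * ((n ∸ i) C (k ∸ l)) * ((n ∸ j) C (k ∸ l))))

{-# OPTIONS --safe #-}
-- A width-one matrix with entry sum d is the multiplicity grid of d lattice points forming a
-- chain, i.e. of a pair (x, y) of weakly decreasing sequences of length d with entries in
-- [0, n).  Hence S(d,n)ᵢⱼ = Σₜ cₜ(i) cₜ(j), where cₜ(i) = C(n-1-i+t, t) C(i+u, i), u = d-1-t,
-- counts the sequences x with xₜ = i.  This is the coefficient of z^(d-1) in
-- F(i,j) F(n-1-i,n-1-j), where F(A,B) = Σₜ C(A+t,A) C(B+t,B) zᵗ.  Both F(A,B) and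
-- Σₗ C(A,l) C(B,l) zˡ / (1-z)^(A+B+1) satisfy the same Pascal-type recurrence in (A, B)
-- and agree when A = 0 or B = 0, so they are equal; multiplying the two rational
-- expressions gives the formula, whose terms with k ≥ n vanish.
module Submission where

open import Defs
open import Data.Nat using (ℕ; zero; suc; _+_; _*_; _∸_; _≤_; _<_; _⊓_; z≤n; s≤s; z<s; s<s; s≤s⁻¹)
open import Data.Nat.Properties
open import Data.Nat.Combinatorics using (_C_; nCk+nC[k+1]≡[n+1]C[k+1]; nCn≡1; k>n⇒nCk≡0)
open import Data.Nat.Solver using (module +-*-Solver)
open import Algebra.Properties.CommutativeSemigroup +-commutativeSemigroup
  using () renaming (interchange to +-interchange)
open import Data.Empty using (⊥-elim)
open import Data.Fin using (Fin; toℕ; fromℕ<)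
open import Data.Fin.Properties using (toℕ-fromℕ<; toℕ<n)
open import Data.Vec using (Vec; lookup; tabulate; replicate)
open import Data.Vec.Properties using (lookup∘tabulate; tabulate∘lookup; tabulate-cong)
open import Data.List using (List; []; _∷_; [_]; _++_; map; concatMap; upTo; applyUpTo; length; allFin; cartesianProduct)
import Data.List as List
open import Data.List.Properties using (map-++; map-cong; map-tabulate; ∷-injectiveˡ; ∷-injectiveʳ)
open import Data.Nat.ListAction using (sum)
open import Data.Nat.ListAction.Properties using (sum-++)
open import Data.List.Membership.Propositional using (_∈_; find; lose)
open import Data.List.Membership.Propositional.Properties
  using (∈-map⁺; ∈-map⁻; ∈-concatMap⁺; ∈-concatMap⁻; ∈-upTo⁺; ∈-upTo⁻;
         ∈-cartesianProduct⁺; ∈-cartesianProduct⁻)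
open import Data.List.Relation.Unary.Any using (here; there)
open import Data.List.Relation.Unary.All as All using (All)
open import Data.List.Relation.Unary.Unique.Propositional using (Unique)
import Data.List.Relation.Unary.Unique.Propositional.Properties as Unique
open import Data.List.Relation.Unary.AllPairs using ([]; _∷_)
open import Function using (_∘′_)
open import Data.Product using (_×_; _,_; ∃-syntax)
open import Function.Bundles using (_⇔_; mk⇔)
open import Data.Sum using (_⊎_; inj₁; inj₂)
open import Relation.Nullary using (¬_; yes; no)
open import Relation.Binary.PropositionalEquality
  using (_≡_; _≢_; _≗_; refl; sym; trans; cong; cong₂; subst; module ≡-Reasoning)
open ≡-Reasoning
open +-*-Solver using (solve; _:+_; _:*_; _:=_; con)

-- Finite sums

∑< : ℕ → (ℕ → ℕ) → ℕ
∑< zero    f = 0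
∑< (suc m) f = f 0 + ∑< m (λ k → f (suc k))

∑<-cong : ∀ m {f g : ℕ → ℕ} → (∀ k → k < m → f k ≡ g k) → ∑< m f ≡ ∑< m g
∑<-cong zero    eq = refl
∑<-cong (suc m) eq = cong₂ _+_ (eq 0 z<s) (∑<-cong m (λ k k<m → eq (suc k) (s<s k<m)))

∑<-+ : ∀ m f g → ∑< m (λ k → f k + g k) ≡ ∑< m f + ∑< m g
∑<-+ zero    f g = refl
∑<-+ (suc m) f g = trans (cong (f 0 + g 0 +_) (∑<-+ m _ _)) (+-interchange (f 0) (g 0) _ _)

∑<-*ˡ : ∀ m c f → ∑< m (λ k → c * f k) ≡ c * ∑< m f
∑<-*ˡ zero    c f = sym (*-zeroʳ c)
∑<-*ˡ (suc m) c f = trans (cong (c * f 0 +_) (∑<-*ˡ m c _)) (sym (*-distribˡ-+ c (f 0) _))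

∑<-*ʳ : ∀ m c f → ∑< m (λ k → f k * c) ≡ ∑< m f * c
∑<-*ʳ m c f = trans (∑<-cong m (λ k _ → *-comm (f k) c)) (trans (∑<-*ˡ m c f) (*-comm c _))

∑<-zero : ∀ m f → (∀ k → k < m → f k ≡ 0) → ∑< m f ≡ 0
∑<-zero zero    f z = refl
∑<-zero (suc m) f z = cong₂ _+_ (z 0 z<s) (∑<-zero m _ (λ k k<m → z (suc k) (s<s k<m)))

∑<-≡0⇒≡0 : ∀ m f → ∑< m f ≡ 0 → ∀ k → k < m → f k ≡ 0
∑<-≡0⇒≡0 (suc m) f eq zero    _         = m+n≡0⇒m≡0 (f 0) eq
∑<-≡0⇒≡0 (suc m) f eq (suc k) (s<s k<m) = ∑<-≡0⇒≡0 m _ (m+n≡0⇒n≡0 (f 0) eq) k k<m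

∑<-last : ∀ m f → ∑< (suc m) f ≡ ∑< m f + f m
∑<-last zero    f = +-identityʳ (f 0)
∑<-last (suc m) f = trans (cong (f 0 +_) (∑<-last m (λ k → f (suc k)))) (sym (+-assoc (f 0) _ _))

∑<-split : ∀ m r f → ∑< (m + r) f ≡ ∑< m f + ∑< r (λ k → f (m + k))
∑<-split zero    r f = refl
∑<-split (suc m) r f = trans (cong (f 0 +_) (∑<-split m r (λ k → f (suc k)))) (sym (+-assoc (f 0) _ _))

∑<-⊓ : ∀ m n f → (∀ k → n ≤ k → f k ≡ 0) → ∑< m f ≡ ∑< (m ⊓ n) f
∑<-⊓ m n f vanish with m ≤? n
... | yes m≤n = cong (λ r → ∑< r f) (sym (m≤n⇒m⊓n≡m m≤n))
... | no  m≰n = begin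
  ∑< m f                                    ≡⟨ cong (λ r → ∑< r f) (sym (m+[n∸m]≡n n≤m)) ⟩
  ∑< (n + (m ∸ n)) f                        ≡⟨ ∑<-split n (m ∸ n) f ⟩
  ∑< n f + ∑< (m ∸ n) (λ k → f (n + k))
    ≡⟨ cong (∑< n f +_) (∑<-zero (m ∸ n) _ (λ k _ → vanish (n + k) (m≤m+n n k))) ⟩
  ∑< n f + 0                                ≡⟨ +-identityʳ _ ⟩
  ∑< n f                                    ≡⟨ cong (λ r → ∑< r f) (sym (m≥n⇒m⊓n≡n n≤m)) ⟩
  ∑< (m ⊓ n) f                              ∎
  where n≤m = <⇒≤ (≰⇒> m≰n)

∑<-lastNonzero : ∀ m f → ∑< m f ≢ 0 →
  ∃[ k ] (k < m × f k ≢ 0 × (∀ k′ → k′ < m → f k′ ≢ 0 → k′ ≤ k))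
∑<-lastNonzero zero f ne = ⊥-elim (ne refl)
∑<-lastNonzero (suc m) f ne with ∑< m (λ k → f (suc k)) ≟ 0
... | no tail≢0 =
  let k , k<m , fk≢0 , maximal = ∑<-lastNonzero m (λ k → f (suc k)) tail≢0
  in suc k , s<s k<m , fk≢0 , λ { zero _ _ → z≤n
                                ; (suc k′) (s<s k′<m) fk′≢0 → s≤s (maximal k′ k′<m fk′≢0) }
... | yes tail≡0 = 0 , z<s , (λ f0≡0 → ne (cong₂ _+_ f0≡0 tail≡0)) ,
  λ { zero _ _ → z≤n
    ; (suc k′) (s<s k′<m) fk′≢0 → ⊥-elim (fk′≢0 (∑<-≡0⇒≡0 m _ tail≡0 k′ k′<m)) }

∑<-≢0 : ∀ m f {k} → k < m → f k ≢ 0 → ∑< m f ≢ 0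
∑<-≢0 m f k<m fk≢0 sum≡0 = fk≢0 (∑<-≡0⇒≡0 m f sum≡0 _ k<m)

δ : ℕ → ℕ → ℕ
δ zero    zero    = 1
δ zero    (suc _) = 0
δ (suc _) zero    = 0
δ (suc a) (suc b) = δ a b

δ-refl : ∀ a → δ a a ≡ 1
δ-refl zero    = refl
δ-refl (suc a) = δ-refl a

δ-≢ : ∀ a b → a ≢ b → δ a b ≡ 0
δ-≢ zero    zero    a≢b = ⊥-elim (a≢b refl)
δ-≢ zero    (suc b) _   = refl
δ-≢ (suc a) zero    _   = refl
δ-≢ (suc a) (suc b) a≢b = δ-≢ a b (a≢b ∘′ cong suc)

δ-≢0⇒≡ : ∀ a b → δ a b ≢ 0 → a ≡ b
δ-≢0⇒≡ zero    zero    _  = refl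
δ-≢0⇒≡ zero    (suc b) ne = ⊥-elim (ne refl)
δ-≢0⇒≡ (suc a) zero    ne = ⊥-elim (ne refl)
δ-≢0⇒≡ (suc a) (suc b) ne = cong suc (δ-≢0⇒≡ a b ne)

∑<-δ : ∀ m a → a < m → ∑< m (δ a) ≡ 1
∑<-δ (suc m) zero    _         = cong suc (∑<-zero m _ (λ _ _ → refl))
∑<-δ (suc m) (suc a) (s<s a<m) = ∑<-δ m a a<m

∑<-δ* : ∀ m a (f : ℕ → ℕ) → a < m → ∑< m (λ k → δ k a * f k) ≡ f a
∑<-δ* (suc m) zero    f _ =
  trans (cong₂ _+_ (+-identityʳ (f 0)) (∑<-zero m _ (λ _ _ → refl))) (+-identityʳ (f 0))
∑<-δ* (suc m) (suc a) f (s<s a<m) = ∑<-δ* m a (λ k → f (suc k)) a<m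

antidiagonal : ℕ → (ℕ → ℕ → ℕ) → ℕ
antidiagonal zero    h = h 0 0
antidiagonal (suc D) h = h 0 (suc D) + antidiagonal D (λ a b → h (suc a) b)

antidiagonal-cong : ∀ D {h k : ℕ → ℕ → ℕ} → (∀ a b → h a b ≡ k a b) → antidiagonal D h ≡ antidiagonal D k
antidiagonal-cong zero    eq = eq 0 0
antidiagonal-cong (suc D) eq = cong₂ _+_ (eq 0 (suc D)) (antidiagonal-cong D (λ a b → eq (suc a) b))

antidiagonal-+ : ∀ D h k → antidiagonal D (λ a b → h a b + k a b) ≡ antidiagonal D h + antidiagonal D k
antidiagonal-+ zero    h k = refl
antidiagonal-+ (suc D) h k =
  trans (cong (h 0 (suc D) + k 0 (suc D) +_) (antidiagonal-+ D _ _)) (+-interchange (h 0 (suc D)) _ _ _)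

antidiagonal-*ˡ : ∀ D c h → antidiagonal D (λ a b → c * h a b) ≡ c * antidiagonal D h
antidiagonal-*ˡ zero    c h = refl
antidiagonal-*ˡ (suc D) c h =
  trans (cong (c * h 0 (suc D) +_) (antidiagonal-*ˡ D c _)) (sym (*-distribˡ-+ c (h 0 (suc D)) _))

antidiagonal-*ʳ : ∀ D c h → antidiagonal D (λ a b → h a b * c) ≡ antidiagonal D h * c
antidiagonal-*ʳ D c h = begin
  antidiagonal D (λ a b → h a b * c) ≡⟨ antidiagonal-cong D (λ a b → *-comm (h a b) c) ⟩
  antidiagonal D (λ a b → c * h a b) ≡⟨ antidiagonal-*ˡ D c h ⟩
  c * antidiagonal D h               ≡⟨ *-comm c _ ⟩
  antidiagonal D h * c               ∎

antidiagonal-zero : ∀ D h → (∀ a b → a + b ≡ D → h a b ≡ 0) → antidiagonal D h ≡ 0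
antidiagonal-zero zero    h z = z 0 0 refl
antidiagonal-zero (suc D) h z =
  cong₂ _+_ (z 0 (suc D) refl) (antidiagonal-zero D _ (λ a b a+b≡D → z (suc a) b (cong suc a+b≡D)))

antidiagonal-last : ∀ D h → antidiagonal (suc D) h ≡ antidiagonal D (λ a b → h a (suc b)) + h (suc D) 0
antidiagonal-last zero    h = refl
antidiagonal-last (suc D) h =
  trans (cong (h 0 (suc (suc D)) +_) (antidiagonal-last D (λ a b → h (suc a) b)))
        (sym (+-assoc (h 0 (suc (suc D))) _ _))

antidiagonal-comm : ∀ D h → antidiagonal D h ≡ antidiagonal D (λ a b → h b a)
antidiagonal-comm zero    h = refl
antidiagonal-comm (suc D) h = begin
  h 0 (suc D) + antidiagonal D (λ a b → h (suc a) b)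
    ≡⟨ cong (h 0 (suc D) +_) (antidiagonal-comm D (λ a b → h (suc a) b)) ⟩
  h 0 (suc D) + antidiagonal D (λ a b → h (suc b) a)
    ≡⟨ +-comm (h 0 (suc D)) _ ⟩
  antidiagonal D (λ a b → h (suc b) a) + h 0 (suc D)
    ≡⟨ sym (antidiagonal-last D (λ a b → h b a)) ⟩
  antidiagonal (suc D) (λ a b → h b a) ∎

antidiagonal-assoc : ∀ D (h : ℕ → ℕ → ℕ → ℕ) →
  antidiagonal D (λ a c → antidiagonal a (λ a₁ a₂ → h a₁ a₂ c)) ≡
  antidiagonal D (λ a₁ b → antidiagonal b (λ a₂ c → h a₁ a₂ c))
antidiagonal-assoc zero    h = refl
antidiagonal-assoc (suc D) h =
  trans (cong (h 0 0 (suc D) +_) (antidiagonal-+ D (λ a c → h 0 (suc a) c) _))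
  (trans (sym (+-assoc (h 0 0 (suc D)) _ _))
         (cong (h 0 0 (suc D) + antidiagonal D (λ a c → h 0 (suc a) c) +_)
               (antidiagonal-assoc D (λ a₁ → h (suc a₁)))))

antidiagonal-∑< : ∀ D h → antidiagonal D h ≡ ∑< (suc D) (λ a → h a (D ∸ a))
antidiagonal-∑< zero    h = sym (+-identityʳ (h 0 0))
antidiagonal-∑< (suc D) h = cong (h 0 (suc D) +_) (antidiagonal-∑< D (λ a b → h (suc a) b))

∑<-antidiagonal : ∀ D (F : ℕ → ℕ → ℕ) → ∑< (suc D) (F D) ≡ antidiagonal D (λ a b → F (a + b) a)
∑<-antidiagonal zero    F = +-identityʳ (F 0 0)
∑<-antidiagonal (suc D) F = cong (F (suc D) 0 +_) (∑<-antidiagonal D (λ s a → F (suc s) (suc a)))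

-- Power series with natural-number coefficients

-- f stands for Σₜ f t zᵗ, so shift is multiplication by z and ⋆ is the Cauchy product.
Series : Set
Series = ℕ → ℕ

infixl 6 _⊕_
infixl 7 _⋆_

_⊕_ : Series → Series → Series
(f ⊕ g) t = f t + g t

_⋆_ : Series → Series → Series
(f ⋆ g) D = antidiagonal D (λ a b → f a * g b)

shift : Series → Series
shift f zero    = 0
shift f (suc t) = f t

ε : Series
ε zero    = 1
ε (suc _) = 0

⋆-cong : ∀ {f f′ g g′} → f ≗ f′ → g ≗ g′ → f ⋆ g ≗ f′ ⋆ g′
⋆-cong f≗f′ g≗g′ D = antidiagonal-cong D (λ a b → cong₂ _*_ (f≗f′ a) (g≗g′ b))

⋆-congˡ : ∀ f {g g′} → g ≗ g′ → f ⋆ g ≗ f ⋆ g′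
⋆-congˡ f = ⋆-cong {f} (λ _ → refl)

⋆-congʳ : ∀ {f f′} g → f ≗ f′ → f ⋆ g ≗ f′ ⋆ g
⋆-congʳ g f≗f′ = ⋆-cong f≗f′ (λ _ → refl)

⋆-comm : ∀ f g → f ⋆ g ≗ g ⋆ f
⋆-comm f g D = trans (antidiagonal-comm D _) (antidiagonal-cong D (λ a b → *-comm (f b) (g a)))

⋆-assoc : ∀ f g h → (f ⋆ g) ⋆ h ≗ f ⋆ (g ⋆ h)
⋆-assoc f g h D = begin
  antidiagonal D (λ a c → antidiagonal a (λ a₁ a₂ → f a₁ * g a₂) * h c)
    ≡⟨ antidiagonal-cong D (λ a c → sym (antidiagonal-*ʳ a (h c) _)) ⟩
  antidiagonal D (λ a c → antidiagonal a (λ a₁ a₂ → f a₁ * g a₂ * h c))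
    ≡⟨ antidiagonal-assoc D (λ a₁ a₂ c → f a₁ * g a₂ * h c) ⟩
  antidiagonal D (λ a₁ b → antidiagonal b (λ a₂ c → f a₁ * g a₂ * h c))
    ≡⟨ antidiagonal-cong D (λ a₁ b → trans (antidiagonal-cong b (λ a₂ c → *-assoc (f a₁) (g a₂) (h c)))
                                           (antidiagonal-*ˡ b (f a₁) _)) ⟩
  antidiagonal D (λ a₁ b → f a₁ * antidiagonal b (λ a₂ c → g a₂ * h c)) ∎

⋆-interchange : ∀ f g h k → (f ⋆ g) ⋆ (h ⋆ k) ≗ (f ⋆ h) ⋆ (g ⋆ k)
⋆-interchange f g h k D = begin
  ((f ⋆ g) ⋆ (h ⋆ k)) D ≡⟨ ⋆-assoc f g (h ⋆ k) D ⟩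
  (f ⋆ (g ⋆ (h ⋆ k))) D ≡⟨ ⋆-congˡ f (λ t → sym (⋆-assoc g h k t)) D ⟩
  (f ⋆ ((g ⋆ h) ⋆ k)) D ≡⟨ ⋆-congˡ f (⋆-congʳ k (⋆-comm g h)) D ⟩
  (f ⋆ ((h ⋆ g) ⋆ k)) D ≡⟨ ⋆-congˡ f (⋆-assoc h g k) D ⟩
  (f ⋆ (h ⋆ (g ⋆ k))) D ≡⟨ sym (⋆-assoc f h (g ⋆ k) D) ⟩
  ((f ⋆ h) ⋆ (g ⋆ k)) D ∎

⋆-distribʳ-⊕ : ∀ f g h → (f ⊕ g) ⋆ h ≗ f ⋆ h ⊕ g ⋆ h
⋆-distribʳ-⊕ f g h D = trans (antidiagonal-cong D (λ a b → *-distribʳ-+ (h b) (f a) (g a))) (antidiagonal-+ D _ _)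

⋆-distribˡ-⊕ : ∀ f g h → f ⋆ (g ⊕ h) ≗ f ⋆ g ⊕ f ⋆ h
⋆-distribˡ-⊕ f g h D = trans (antidiagonal-cong D (λ a b → *-distribˡ-+ (f a) (g b) (h b))) (antidiagonal-+ D _ _)

shift-⋆ : ∀ f g → shift f ⋆ g ≗ shift (f ⋆ g)
shift-⋆ f g zero    = refl
shift-⋆ f g (suc D) = refl

⋆-shift : ∀ f g → f ⋆ shift g ≗ shift (f ⋆ g)
⋆-shift f g zero    = *-zeroʳ (f 0)
⋆-shift f g (suc D) = trans (⋆-comm f (shift g) (suc D)) (⋆-comm g f D)

ε-⋆ : ∀ f → ε ⋆ f ≗ f
ε-⋆ f zero    = +-identityʳ (f 0)
ε-⋆ f (suc D) = trans (cong₂ _+_ (+-identityʳ (f (suc D))) (antidiagonal-zero D _ (λ _ _ _ → refl))) (+-identityʳ _)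

shift-recurrence-unique : ∀ {u v} f → u ≗ f ⊕ shift u → v ≗ f ⊕ shift v → u ≗ v
shift-recurrence-unique f u≗ v≗ zero    = trans (u≗ 0) (sym (v≗ 0))
shift-recurrence-unique f u≗ v≗ (suc t) =
  trans (u≗ (suc t)) (trans (cong (f (suc t) +_) (shift-recurrence-unique f u≗ v≗ t)) (sym (v≗ (suc t))))

pascal-⋆ : ∀ g {u v w} → w ≗ u ⊕ shift v → w ⋆ g ≗ u ⋆ g ⊕ shift (v ⋆ g)
pascal-⋆ g {u} {v} {w} w≗ t = begin
  (w ⋆ g) t                      ≡⟨ ⋆-congʳ g w≗ t ⟩
  ((u ⊕ shift v) ⋆ g) t          ≡⟨ ⋆-distribʳ-⊕ u (shift v) g t ⟩
  (u ⋆ g) t + (shift v ⋆ g) t    ≡⟨ cong ((u ⋆ g) t +_) (shift-⋆ v g t) ⟩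
  (u ⋆ g) t + shift (v ⋆ g) t    ∎

⋆-pascal : ∀ g {u v w} → w ≗ u ⊕ shift v → g ⋆ w ≗ g ⋆ u ⊕ shift (g ⋆ v)
⋆-pascal g {u} {v} {w} w≗ t = begin
  (g ⋆ w) t                      ≡⟨ ⋆-congˡ g w≗ t ⟩
  (g ⋆ (u ⊕ shift v)) t          ≡⟨ ⋆-distribˡ-⊕ g u (shift v) t ⟩
  (g ⋆ u) t + (g ⋆ shift v) t    ≡⟨ cong ((g ⋆ u) t +_) (⋆-shift g v t) ⟩
  (g ⋆ u) t + shift (g ⋆ v) t    ∎

-- The coefficients of (1 - z)^-(N+1).
negBinom : ℕ → Series
negBinom N t = (N + t) C N

negBinom-at-0 : ∀ N → negBinom N 0 ≡ 1
negBinom-at-0 N = trans (cong (_C N) (+-identityʳ N)) (nCn≡1 N)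

negBinom-pascal : ∀ N → negBinom (suc N) ≗ negBinom N ⊕ shift (negBinom (suc N))
negBinom-pascal N zero = trans (negBinom-at-0 (suc N)) (sym (trans (+-identityʳ _) (negBinom-at-0 N)))
negBinom-pascal N (suc t) = begin
  suc (N + suc t) C suc N                ≡⟨ sym (nCk+nC[k+1]≡[n+1]C[k+1] (N + suc t) N) ⟩
  (N + suc t) C N + (N + suc t) C suc N  ≡⟨ cong (λ m → (N + suc t) C N + m C suc N) (+-suc N t) ⟩
  (N + suc t) C N + suc (N + t) C suc N  ∎

negBinom-0-pascal : negBinom 0 ≗ ε ⊕ shift (negBinom 0)
negBinom-0-pascal zero    = refl
negBinom-0-pascal (suc t) = refl

negBinom-⋆ : ∀ p q → negBinom p ⋆ negBinom q ≗ negBinom (suc (p + q))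
negBinom-⋆ zero    q = shift-recurrence-unique (negBinom q)
  (λ t → trans (pascal-⋆ (negBinom q) negBinom-0-pascal t) (cong (_+ shift (negBinom 0 ⋆ negBinom q) t) (ε-⋆ (negBinom q) t)))
  (negBinom-pascal q)
negBinom-⋆ (suc p) q = shift-recurrence-unique (negBinom (suc (p + q)))
  (λ t → trans (pascal-⋆ (negBinom q) (negBinom-pascal p) t)
                (cong (_+ shift (negBinom (suc p) ⋆ negBinom q) t) (negBinom-⋆ p q t)))
  (negBinom-pascal (suc (p + q)))

-- Products of negative binomial series

infixl 8 _⊙_

_⊙_ : Series → Series → Series
(f ⊙ g) t = f t * g t

shift-⊙ : ∀ f g → shift (f ⊙ g) ≗ shift f ⊙ shift g
shift-⊙ f g zero    = refl
shift-⊙ f g (suc t) = refl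

⊙-recurrence : ∀ {u u′ v v′} s r → u′ ≗ u ⊕ s → v′ ≗ v ⊕ r →
  u′ ⊙ v′ ⊕ u ⊙ v ≗ u ⊙ v′ ⊕ u′ ⊙ v ⊕ s ⊙ r
⊙-recurrence {u} {u′} {v} {v′} s r u′≗ v′≗ t = begin
  u′ t * v′ t + u t * v t
    ≡⟨ cong₂ (λ x y → x * y + u t * v t) (u′≗ t) (v′≗ t) ⟩
  (u t + s t) * (v t + r t) + u t * v t
    ≡⟨ identity (u t) (s t) (v t) (r t) ⟩
  u t * (v t + r t) + (u t + s t) * v t + s t * r t
    ≡⟨ cong₂ (λ x y → u t * y + x * v t + s t * r t) (sym (u′≗ t)) (sym (v′≗ t)) ⟩
  u t * v′ t + u′ t * v t + s t * r t ∎
  where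
  identity : ∀ a s b r → (a + s) * (b + r) + a * b ≡ a * (b + r) + (a + s) * b + s * r
  identity = solve 4 (λ a s b r → (a :+ s) :* (b :+ r) :+ a :* b := a :* (b :+ r) :+ (a :+ s) :* b :+ s :* r) refl

-- (1 - z) F(A+1,B+1) = F(A,B+1) + F(A+1,B) - F(A,B), written without subtraction.
SquareRecurrence : (ℕ → ℕ → Series) → Set
SquareRecurrence F = ∀ A B → F (suc A) (suc B) ⊕ F A B ≗ F A (suc B) ⊕ F (suc A) B ⊕ shift (F (suc A) (suc B))

squareRecurrence-step : ∀ F G → SquareRecurrence F → SquareRecurrence G → ∀ A B t →
  F A B t ≡ G A B t → F A (suc B) t ≡ G A (suc B) t → F (suc A) B t ≡ G (suc A) B t →
  shift (F (suc A) (suc B)) t ≡ shift (G (suc A) (suc B)) t → F (suc A) (suc B) t ≡ G (suc A) (suc B) t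
squareRecurrence-step F G recF recG A B t eq₀₀ eq₀₁ eq₁₀ eqₛ = +-cancelʳ-≡ (F A B t) _ _ (begin
  F (suc A) (suc B) t + F A B t
    ≡⟨ recF A B t ⟩
  F A (suc B) t + F (suc A) B t + shift (F (suc A) (suc B)) t
    ≡⟨ cong₂ _+_ (cong₂ _+_ eq₀₁ eq₁₀) eqₛ ⟩
  G A (suc B) t + G (suc A) B t + shift (G (suc A) (suc B)) t
    ≡⟨ sym (recG A B t) ⟩
  G (suc A) (suc B) t + G A B t
    ≡⟨ cong (G (suc A) (suc B) t +_) (sym eq₀₀) ⟩
  G (suc A) (suc B) t + F A B t ∎)

squareRecurrence-unique : ∀ F G → SquareRecurrence F → SquareRecurrence G →
  (∀ B → F 0 B ≗ G 0 B) → (∀ A → F A 0 ≗ G A 0) → ∀ A B → F A B ≗ G A B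
squareRecurrence-unique F G recF recG eq₀ eq₁ zero    B       t = eq₀ B t
squareRecurrence-unique F G recF recG eq₀ eq₁ (suc A) zero    t = eq₁ (suc A) t
squareRecurrence-unique F G recF recG eq₀ eq₁ (suc A) (suc B) zero =
  squareRecurrence-step F G recF recG A B 0 (unique A B 0) (unique A (suc B) 0) (unique (suc A) B 0) refl
  where unique = squareRecurrence-unique F G recF recG eq₀ eq₁
squareRecurrence-unique F G recF recG eq₀ eq₁ (suc A) (suc B) (suc t) =
  squareRecurrence-step F G recF recG A B (suc t) (unique A B (suc t)) (unique A (suc B) (suc t))
    (unique (suc A) B (suc t)) (unique (suc A) (suc B) t)
  where unique = squareRecurrence-unique F G recF recG eq₀ eq₁

binom : ℕ → Series
binom A l = A C l

binom-pascal : ∀ A → binom (suc A) ≗ binom A ⊕ shift (binom A)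
binom-pascal A zero    = refl
binom-pascal A (suc l) = trans (sym (nCk+nC[k+1]≡[n+1]C[k+1] A l)) (+-comm (A C l) _)

binomProd-recurrence : ∀ A B →
  binom (suc A) ⊙ binom (suc B) ⊕ binom A ⊙ binom B ≗
  binom A ⊙ binom (suc B) ⊕ binom (suc A) ⊙ binom B ⊕ shift (binom A ⊙ binom B)
binomProd-recurrence A B t =
  trans (⊙-recurrence (shift (binom A)) (shift (binom B)) (binom-pascal A) (binom-pascal B) t)
        (cong ((binom A ⊙ binom (suc B) ⊕ binom (suc A) ⊙ binom B) t +_) (sym (shift-⊙ (binom A) (binom B) t)))

negBinomProd-recurrence : SquareRecurrence (λ A B → negBinom A ⊙ negBinom B)
negBinomProd-recurrence A B t =
  trans (⊙-recurrence (shift (negBinom (suc A))) (shift (negBinom (suc B)))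
                      (negBinom-pascal A) (negBinom-pascal B) t)
        (cong ((negBinom A ⊙ negBinom (suc B) ⊕ negBinom (suc A) ⊙ negBinom B) t +_)
              (sym (shift-⊙ (negBinom (suc A)) (negBinom (suc B)) t)))

binomSeries : ℕ → ℕ → Series
binomSeries A B = binom A ⊙ binom B ⋆ negBinom (A + B)

binomSeries-recurrence : SquareRecurrence binomSeries
binomSeries-recurrence A B t = +-cancelʳ-≡ c _ _ (begin
  R₁₁ t + R₀₀ t + c
    ≡⟨ cong (λ x → x + R₀₀ t + c) (⋆-pascal g₁₁ pascal₁₁ t) ⟩
  (g₁₁ ⋆ b₁) t + shift R₁₁ t + R₀₀ t + c
    ≡⟨ rearrange ((g₁₁ ⋆ b₁) t) (shift R₁₁ t) (R₀₀ t) c ⟩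
  (g₁₁ ⋆ b₁) t + (R₀₀ t + c) + shift R₁₁ t
    ≡⟨ cong (λ x → (g₁₁ ⋆ b₁) t + x + shift R₁₁ t) lower ⟩
  (g₁₁ ⋆ b₁) t + (g₀₀ ⋆ b₁) t + shift R₁₁ t
    ≡⟨ cong (_+ shift R₁₁ t) (sym (⋆-distribʳ-⊕ g₁₁ g₀₀ b₁ t)) ⟩
  ((g₁₁ ⊕ g₀₀) ⋆ b₁) t + shift R₁₁ t
    ≡⟨ cong (_+ shift R₁₁ t) (⋆-congʳ b₁ (binomProd-recurrence A B) t) ⟩
  ((g₀₁ ⊕ g₁₀ ⊕ shift g₀₀) ⋆ b₁) t + shift R₁₁ t
    ≡⟨ cong (_+ shift R₁₁ t) (trans (⋆-distribʳ-⊕ (g₀₁ ⊕ g₁₀) _ b₁ t)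
                                    (cong (_+ c) (⋆-distribʳ-⊕ g₀₁ g₁₀ b₁ t))) ⟩
  (g₀₁ ⋆ b₁) t + (g₁₀ ⋆ b₁) t + c + shift R₁₁ t
    ≡⟨ rearrange′ ((g₀₁ ⋆ b₁) t) ((g₁₀ ⋆ b₁) t) c (shift R₁₁ t) ⟩
  (g₀₁ ⋆ b₁) t + (g₁₀ ⋆ b₁) t + shift R₁₁ t + c
    ≡⟨ cong (λ x → x + (g₁₀ ⋆ b₁) t + shift R₁₁ t + c) (sym (R₀₁ t)) ⟩
  binomSeries A (suc B) t + binomSeries (suc A) B t + shift (binomSeries (suc A) (suc B)) t + c ∎)
  where
  N = A + B
  b₁ = negBinom (suc N)
  g₀₀ = binom A ⊙ binom B
  g₀₁ = binom A ⊙ binom (suc B)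
  g₁₀ = binom (suc A) ⊙ binom B
  g₁₁ = binom (suc A) ⊙ binom (suc B)
  R₀₀ = binomSeries A B
  R₁₁ = binomSeries (suc A) (suc B)
  c = (shift g₀₀ ⋆ b₁) t
  R₀₁ : binomSeries A (suc B) ≗ g₀₁ ⋆ b₁
  R₀₁ t = cong (λ m → (g₀₁ ⋆ negBinom m) t) (+-suc A B)
  pascal₁₁ : negBinom (suc A + suc B) ≗ b₁ ⊕ shift (negBinom (suc A + suc B))
  pascal₁₁ = subst (λ m → negBinom (suc m) ≗ b₁ ⊕ shift (negBinom (suc m))) (sym (+-suc A B))
                   (negBinom-pascal (suc N))
  lower : R₀₀ t + c ≡ (g₀₀ ⋆ b₁) t
  lower = sym (trans (⋆-pascal g₀₀ (negBinom-pascal N) t) (cong (R₀₀ t +_) (sym (shift-⋆ g₀₀ b₁ t))))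
  rearrange : ∀ a s r c → a + s + r + c ≡ a + (r + c) + s
  rearrange = solve 4 (λ a s r c → a :+ s :+ r :+ c := a :+ (r :+ c) :+ s) refl
  rearrange′ : ∀ x y c s → x + y + c + s ≡ x + y + s + c
  rearrange′ = solve 4 (λ x y c s → x :+ y :+ c :+ s := x :+ y :+ s :+ c) refl

binom-0-⊙ : ∀ B → binom 0 ⊙ binom B ≗ ε
binom-0-⊙ B zero    = refl
binom-0-⊙ B (suc l) = refl

⊙-binom-0 : ∀ A → binom A ⊙ binom 0 ≗ ε
⊙-binom-0 A zero    = refl
⊙-binom-0 A (suc l) = *-zeroʳ (A C suc l)

negBinomProd≗binomSeries : ∀ A B → negBinom A ⊙ negBinom B ≗ binomSeries A B
negBinomProd≗binomSeries = squareRecurrence-unique _ binomSeries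
  negBinomProd-recurrence binomSeries-recurrence edge₀ edge₁
  where
  edge₀ : ∀ B → negBinom 0 ⊙ negBinom B ≗ binomSeries 0 B
  edge₀ B t = begin
    negBinom 0 t * negBinom B t        ≡⟨ *-identityˡ _ ⟩
    negBinom B t                       ≡⟨ sym (ε-⋆ (negBinom B) t) ⟩
    (ε ⋆ negBinom B) t                 ≡⟨ sym (⋆-congʳ (negBinom B) (binom-0-⊙ B) t) ⟩
    binomSeries 0 B t                  ∎
  edge₁ : ∀ A → negBinom A ⊙ negBinom 0 ≗ binomSeries A 0
  edge₁ A t = begin
    negBinom A t * 1                   ≡⟨ *-identityʳ _ ⟩
    negBinom A t                       ≡⟨ sym (ε-⋆ (negBinom A) t) ⟩
    (ε ⋆ negBinom A) t
      ≡⟨ sym (⋆-cong (⊙-binom-0 A) (λ u → cong (λ m → negBinom m u) (+-identityʳ A)) t) ⟩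
    binomSeries A 0 t                  ∎

negBinomProd-⋆ : ∀ i j q q′ →
  (negBinom i ⊙ negBinom j) ⋆ (negBinom q ⊙ negBinom q′) ≗
  (binom i ⊙ binom j ⋆ binom q ⊙ binom q′) ⋆ negBinom (suc (i + j + (q + q′)))
negBinomProd-⋆ i j q q′ D = begin
  ((negBinom i ⊙ negBinom j) ⋆ (negBinom q ⊙ negBinom q′)) D
    ≡⟨ ⋆-cong (negBinomProd≗binomSeries i j) (negBinomProd≗binomSeries q q′) D ⟩
  (binomSeries i j ⋆ binomSeries q q′) D
    ≡⟨ ⋆-interchange (binom i ⊙ binom j) (negBinom (i + j)) (binom q ⊙ binom q′) (negBinom (q + q′)) D ⟩
  ((binom i ⊙ binom j ⋆ binom q ⊙ binom q′) ⋆ (negBinom (i + j) ⋆ negBinom (q + q′))) D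
    ≡⟨ ⋆-congˡ (binom i ⊙ binom j ⋆ binom q ⊙ binom q′) (negBinom-⋆ (i + j) (q + q′)) D ⟩
  ((binom i ⊙ binom j ⋆ binom q ⊙ binom q′) ⋆ negBinom (suc (i + j + (q + q′)))) D ∎

⊙⋆⊙-vanishes : ∀ i q f g k → i + q < k → (binom i ⊙ f ⋆ binom q ⊙ g) k ≡ 0
⊙⋆⊙-vanishes i q f g k i+q<k = antidiagonal-zero k _ vanish
  where
  vanish : ∀ l m → l + m ≡ k → binom i l * f l * (binom q m * g m) ≡ 0
  vanish l m l+m≡k with l ≤? i | m ≤? q
  ... | yes l≤i | yes m≤q = ⊥-elim (<-irrefl l+m≡k (≤-<-trans (+-mono-≤ l≤i m≤q) i+q<k))
  ... | yes _   | no  m≰q = trans (cong (λ x → binom i l * f l * (x * g m)) (k>n⇒nCk≡0 (≰⇒> m≰q)))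
                                  (*-zeroʳ (binom i l * f l))
  ... | no  l≰i | _       = cong (λ x → x * f l * (binom q m * g m)) (k>n⇒nCk≡0 (≰⇒> l≰i))

sumMap : ∀ {A : Set} → (A → ℕ) → List A → ℕ
sumMap F xs = sum (map F xs)

sumMap-cong : ∀ {A : Set} {F G : A → ℕ} xs → (∀ x → F x ≡ G x) → sumMap F xs ≡ sumMap G xs
sumMap-cong []       eq = refl
sumMap-cong (x ∷ xs) eq = cong₂ _+_ (eq x) (sumMap-cong xs eq)

sumMap-zero : ∀ {A : Set} (F : A → ℕ) xs → (∀ x → F x ≡ 0) → sumMap F xs ≡ 0
sumMap-zero F []       z = refl
sumMap-zero F (x ∷ xs) z = cong₂ _+_ (z x) (sumMap-zero F xs z)

sumMap-*ˡ : ∀ {A : Set} c (F : A → ℕ) xs → sumMap (λ x → c * F x) xs ≡ c * sumMap F xs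
sumMap-*ˡ c F []       = sym (*-zeroʳ c)
sumMap-*ˡ c F (x ∷ xs) = trans (cong (c * F x +_) (sumMap-*ˡ c F xs)) (sym (*-distribˡ-+ c (F x) _))

sumMap-*ʳ : ∀ {A : Set} c (F : A → ℕ) xs → sumMap (λ x → F x * c) xs ≡ sumMap F xs * c
sumMap-*ʳ c F xs = trans (sumMap-cong xs (λ x → *-comm (F x) c)) (trans (sumMap-*ˡ c F xs) (*-comm c _))

sumMap-++ : ∀ {A : Set} (F : A → ℕ) xs ys → sumMap F (xs ++ ys) ≡ sumMap F xs + sumMap F ys
sumMap-++ F xs ys = trans (cong sum (map-++ F xs ys)) (sum-++ (map F xs) (map F ys))

sumMap-map : ∀ {A B : Set} (F : B → ℕ) (f : A → B) xs → sumMap F (map f xs) ≡ sumMap (λ x → F (f x)) xs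
sumMap-map F f []       = refl
sumMap-map F f (x ∷ xs) = cong (F (f x) +_) (sumMap-map F f xs)

sumMap-concatMap : ∀ {A B : Set} (F : B → ℕ) (f : A → List B) xs →
  sumMap F (concatMap f xs) ≡ sumMap (λ x → sumMap F (f x)) xs
sumMap-concatMap F f []       = refl
sumMap-concatMap F f (x ∷ xs) =
  trans (sumMap-++ F (f x) (concatMap f xs)) (cong (sumMap F (f x) +_) (sumMap-concatMap F f xs))

sumMap-∑< : ∀ {A : Set} m (F : A → ℕ → ℕ) xs →
  sumMap (λ x → ∑< m (F x)) xs ≡ ∑< m (λ t → sumMap (λ x → F x t) xs)
sumMap-∑< m F []       = sym (∑<-zero m _ (λ _ _ → refl))
sumMap-∑< m F (x ∷ xs) = trans (cong (∑< m (F x) +_) (sumMap-∑< m F xs)) (sym (∑<-+ m (F x) _))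

sumMap-applyUpTo : ∀ (F : ℕ → ℕ) f m → sumMap F (applyUpTo f m) ≡ ∑< m (λ k → F (f k))
sumMap-applyUpTo F f zero    = refl
sumMap-applyUpTo F f (suc m) = cong (F (f 0) +_) (sumMap-applyUpTo F (λ k → f (suc k)) m)

sumMap-upTo : ∀ (F : ℕ → ℕ) m → sumMap F (upTo m) ≡ ∑< m F
sumMap-upTo F = sumMap-applyUpTo F (λ k → k)

sumMap-cartesianProduct : ∀ {A B : Set} (F : A × B → ℕ) xs ys →
  sumMap F (cartesianProduct xs ys) ≡ sumMap (λ x → sumMap (λ y → F (x , y)) ys) xs
sumMap-cartesianProduct F []       ys = refl
sumMap-cartesianProduct F (x ∷ xs) ys = begin
  sumMap F (map (x ,_) ys ++ cartesianProduct xs ys)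
    ≡⟨ sumMap-++ F (map (x ,_) ys) _ ⟩
  sumMap F (map (x ,_) ys) + sumMap F (cartesianProduct xs ys)
    ≡⟨ cong₂ _+_ (sumMap-map F (x ,_) ys) (sumMap-cartesianProduct F xs ys) ⟩
  sumMap (λ y → F (x , y)) ys + sumMap (λ x → sumMap (λ y → F (x , y)) ys) xs ∎

map⁺-onMembers : ∀ {A B : Set} (f : A → B) {xs} → Unique xs →
  (∀ {x y} → x ∈ xs → y ∈ xs → f x ≡ f y → x ≡ y) → Unique (map f xs)
map⁺-onMembers f {[]}     []           inj = []
map⁺-onMembers f {x ∷ xs} (x∉ ∷ uniq) inj =
  All.tabulate (λ fy∈ fx≡fy → let y , y∈xs , fy≡ = ∈-map⁻ f fy∈
                              in All.lookup x∉ y∈xs (inj (here refl) (there y∈xs) (trans fx≡fy fy≡)))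
  ∷ map⁺-onMembers f uniq (λ x∈ y∈ → inj (there x∈) (there y∈))

Unique-concatMap-∷ : ∀ {A : Set} (L : A → List (List A)) {vs} → Unique vs → (∀ v → Unique (L v)) →
  Unique (concatMap (λ v → map (v ∷_) (L v)) vs)
Unique-concatMap-∷ L {[]}     []           uniqL = []
Unique-concatMap-∷ L {v ∷ vs} (v∉ ∷ uniq) uniqL =
  Unique.++⁺ (Unique.map⁺ ∷-injectiveʳ (uniqL v)) (Unique-concatMap-∷ L uniq uniqL) disjoint
  where
  disjoint : ∀ {xs} → ¬ (xs ∈ map (v ∷_) (L v) × xs ∈ concatMap (λ w → map (w ∷_) (L w)) vs)
  disjoint (xs∈ , xs∈′) with w , w∈ , xs∈″ ← find (∈-concatMap⁻ (λ w → map (w ∷_) (L w)) {xs = vs} xs∈′) =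
    let _ , _ , xs≡ = ∈-map⁻ (v ∷_) xs∈ ; _ , _ , xs≡′ = ∈-map⁻ (w ∷_) xs∈″
    in All.lookup v∉ w∈ (∷-injectiveˡ (trans (sym xs≡) xs≡′))

-- Weakly decreasing sequences

data Descending : ℕ → List ℕ → Set where
  []  : ∀ {m} → Descending m []
  _∷_ : ∀ {m v xs} → v < m → Descending (suc v) xs → Descending m (v ∷ xs)

Descending-weaken : ∀ {m m′ xs} → m ≤ m′ → Descending m xs → Descending m′ xs
Descending-weaken m≤m′ []            = []
Descending-weaken m≤m′ (v<m ∷ desc) = <-≤-trans v<m m≤m′ ∷ desc

descending : ℕ → ℕ → List (List ℕ)
descending zero    m = [ [] ]
descending (suc d) m = concatMap (λ v → map (v ∷_) (descending d (suc v))) (upTo m)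

∈-descending⁻ : ∀ d m {xs} → xs ∈ descending d m → Descending m xs × length xs ≡ d
∈-descending⁻ zero    m (here refl) = [] , refl
∈-descending⁻ (suc d) m xs∈
  with v , v∈ , xs∈′ ← find (∈-concatMap⁻ (λ v → map (v ∷_) (descending d (suc v))) {xs = upTo m} xs∈)
  with ys , ys∈ , refl ← ∈-map⁻ (v ∷_) xs∈′
  with desc , len ← ∈-descending⁻ d (suc v) ys∈
  = ∈-upTo⁻ v∈ ∷ desc , cong suc len

∈-descending⁺ : ∀ {m xs} → Descending m xs → xs ∈ descending (length xs) m
∈-descending⁺ []                       = here refl
∈-descending⁺ {m} {v ∷ xs} (v<m ∷ desc) =
  ∈-concatMap⁺ (λ v → map (v ∷_) (descending (length xs) (suc v)))
    (lose (∈-upTo⁺ v<m) (∈-map⁺ (v ∷_) (∈-descending⁺ desc)))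

descending-unique : ∀ d m → Unique (descending d m)
descending-unique zero    m = All.[] ∷ []
descending-unique (suc d) m =
  Unique-concatMap-∷ (λ v → descending d (suc v)) (Unique.upTo⁺ m) (λ v → descending-unique d (suc v))

sumMap-descending : ∀ (F : List ℕ → ℕ) d m →
  sumMap F (descending (suc d) m) ≡ ∑< m (λ v → sumMap (λ xs → F (v ∷ xs)) (descending d (suc v)))
sumMap-descending F d m = begin
  sumMap F (concatMap (λ v → map (v ∷_) (descending d (suc v))) (upTo m))
    ≡⟨ sumMap-concatMap F _ (upTo m) ⟩
  sumMap (λ v → sumMap F (map (v ∷_) (descending d (suc v)))) (upTo m)
    ≡⟨ sumMap-cong (upTo m) (λ v → sumMap-map F (v ∷_) (descending d (suc v))) ⟩
  sumMap (λ v → sumMap (λ xs → F (v ∷ xs)) (descending d (suc v))) (upTo m)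
    ≡⟨ sumMap-upTo _ m ⟩
  ∑< m (λ v → sumMap (λ xs → F (v ∷ xs)) (descending d (suc v))) ∎

∑<-negBinom : ∀ q t → ∑< (suc q) (λ w → negBinom w t) ≡ negBinom q (suc t)
∑<-negBinom zero    t = refl
∑<-negBinom (suc q) t = begin
  ∑< (suc (suc q)) (λ w → negBinom w t)           ≡⟨ ∑<-last (suc q) (λ w → negBinom w t) ⟩
  ∑< (suc q) (λ w → negBinom w t) + negBinom (suc q) t
    ≡⟨ cong (_+ negBinom (suc q) t) (∑<-negBinom q t) ⟩
  negBinom q (suc t) + negBinom (suc q) t        ≡⟨ sym (negBinom-pascal q (suc t)) ⟩
  negBinom (suc q) (suc t)                       ∎

count-descending : ∀ d N → sumMap (λ _ → 1) (descending d (suc N)) ≡ negBinom N d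
count-descending zero    N = sym (negBinom-at-0 N)
count-descending (suc d) N = begin
  sumMap (λ _ → 1) (descending (suc d) (suc N))                 ≡⟨ sumMap-descending (λ _ → 1) d (suc N) ⟩
  ∑< (suc N) (λ v → sumMap (λ _ → 1) (descending d (suc v)))   ≡⟨ ∑<-cong (suc N) (λ v _ → count-descending d v) ⟩
  ∑< (suc N) (λ v → negBinom v d)                               ≡⟨ ∑<-negBinom N d ⟩
  negBinom N (suc d)                                            ∎

δ-at : List ℕ → ℕ → ℕ → ℕ
δ-at []       t       i = 0
δ-at (v ∷ xs) zero    i = δ v i
δ-at (v ∷ xs) (suc t) i = δ-at xs t i

countAt : ℕ → ℕ → ℕ → ℕ → ℕ
countAt d m t i = sumMap (λ xs → δ-at xs t i) (descending d m)

countAt-vanishes : ∀ d m t i → m ≤ i → countAt d m t i ≡ 0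
countAt-vanishes zero    m t       i m≤i = refl
countAt-vanishes (suc d) m zero    i m≤i = trans (sumMap-descending _ d m)
  (∑<-zero m _ (λ v v<m → sumMap-zero (λ _ → δ v i) (descending d (suc v))
                                      (λ _ → δ-≢ v i (<⇒≢ (<-≤-trans v<m m≤i)))))
countAt-vanishes (suc d) m (suc t) i m≤i = trans (sumMap-descending _ d m)
  (∑<-zero m _ (λ v v<m → countAt-vanishes d (suc v) t i (≤-trans v<m m≤i)))

-- The t entries before position t range over [i, i + q], the u entries after it over [0, i].
countAt-closed : ∀ t u i q → countAt (suc (t + u)) (suc (i + q)) t i ≡ negBinom q t * negBinom i u
countAt-closed zero u i q = begin
  countAt (suc u) (suc (i + q)) 0 i
    ≡⟨ sumMap-descending _ u (suc (i + q)) ⟩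
  ∑< (suc (i + q)) (λ v → sumMap (λ _ → δ v i) (descending u (suc v)))
    ≡⟨ ∑<-cong (suc (i + q)) (λ v _ → trans (sumMap-cong (descending u (suc v)) (λ _ → sym (*-identityʳ (δ v i))))
                                            (sumMap-*ˡ (δ v i) (λ _ → 1) (descending u (suc v)))) ⟩
  ∑< (suc (i + q)) (λ v → δ v i * sumMap (λ _ → 1) (descending u (suc v)))
    ≡⟨ ∑<-δ* (suc (i + q)) i (λ v → sumMap (λ _ → 1) (descending u (suc v))) (s≤s (m≤m+n i q)) ⟩
  sumMap (λ _ → 1) (descending u (suc i))
    ≡⟨ count-descending u i ⟩
  negBinom i u
    ≡⟨ sym (trans (cong (_* negBinom i u) (negBinom-at-0 q)) (*-identityˡ _)) ⟩
  negBinom q 0 * negBinom i u ∎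
countAt-closed (suc t) u i q = begin
  countAt (suc (suc t + u)) (suc (i + q)) (suc t) i
    ≡⟨ sumMap-descending _ (suc (t + u)) (suc (i + q)) ⟩
  ∑< (suc (i + q)) (λ v → countAt (suc (t + u)) (suc v) t i)
    ≡⟨ cong (λ m → ∑< m (λ v → countAt (suc (t + u)) (suc v) t i)) (sym (+-suc i q)) ⟩
  ∑< (i + suc q) (λ v → countAt (suc (t + u)) (suc v) t i)
    ≡⟨ ∑<-split i (suc q) _ ⟩
  ∑< i (λ v → countAt (suc (t + u)) (suc v) t i) + ∑< (suc q) (λ w → countAt (suc (t + u)) (suc (i + w)) t i)
    ≡⟨ cong₂ _+_ (∑<-zero i _ (λ v v<i → countAt-vanishes (suc (t + u)) (suc v) t i v<i))
                 (∑<-cong (suc q) (λ w _ → countAt-closed t u i w)) ⟩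
  ∑< (suc q) (λ w → negBinom w t * negBinom i u)
    ≡⟨ ∑<-*ʳ (suc q) (negBinom i u) (λ w → negBinom w t) ⟩
  ∑< (suc q) (λ w → negBinom w t) * negBinom i u
    ≡⟨ cong (_* negBinom i u) (∑<-negBinom q t) ⟩
  negBinom q (suc t) * negBinom i u ∎

-- Chains of lattice points

pairCount : ℕ → List ℕ → List ℕ → ℕ → ℕ → ℕ
pairCount d xs ys a b = ∑< d (λ t → δ-at xs t a * δ-at ys t b)

pairCount-[]ˡ : ∀ d ys a b → pairCount d [] ys a b ≡ 0
pairCount-[]ˡ d ys a b = ∑<-zero d _ (λ _ _ → refl)

pairCount-[]ʳ : ∀ d xs a b → pairCount d xs [] a b ≡ 0
pairCount-[]ʳ d xs a b = ∑<-zero d _ (λ t _ → *-zeroʳ (δ-at xs t a))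

pairCount-∷⁻ : ∀ d v c xs ys a b → pairCount (suc d) (v ∷ xs) (c ∷ ys) a b ≢ 0 →
  (v ≡ a × c ≡ b) ⊎ pairCount d xs ys a b ≢ 0
pairCount-∷⁻ d v c xs ys a b ne with δ v a * δ c b ≟ 0
... | yes head≡0 = inj₂ (λ tail≡0 → ne (cong₂ _+_ head≡0 tail≡0))
... | no  head≢0 = inj₁ (δ-≢0⇒≡ v a (λ e → head≢0 (cong (_* δ c b) e)) ,
                         δ-≢0⇒≡ c b (λ e → head≢0 (trans (cong (δ v a *_) e) (*-zeroʳ (δ v a)))))

pairCount-∷-head : ∀ d v c xs ys → pairCount (suc d) (v ∷ xs) (c ∷ ys) v c ≢ 0
pairCount-∷-head d v c xs ys eq =
  0≢1+n (trans (sym eq) (cong₂ (λ x y → x * y + pairCount d xs ys v c) (δ-refl v) (δ-refl c)))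

pairCount-support : ∀ d {m m′ xs ys a b} → Descending m xs → Descending m′ ys →
  pairCount d xs ys a b ≢ 0 → a < m × b < m′
pairCount-support zero    _ _ ne = ⊥-elim (ne refl)
pairCount-support (suc d) {ys = ys} {a} {b} [] _ ne = ⊥-elim (ne (pairCount-[]ˡ (suc d) ys a b))
pairCount-support (suc d) {xs = xs} {a = a} {b} (_ ∷ _) [] ne = ⊥-elim (ne (pairCount-[]ʳ (suc d) xs a b))
pairCount-support (suc d) {xs = v ∷ xs} {c ∷ ys} {a} {b} (v<m ∷ dxs) (c<m′ ∷ dys) ne
  with pairCount-∷⁻ d v c xs ys a b ne
... | inj₁ (refl , refl) = v<m , c<m′
... | inj₂ ne′ = let a<v+1 , b<c+1 = pairCount-support d dxs dys ne′
                 in <-≤-trans a<v+1 v<m , <-≤-trans b<c+1 c<m′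

pairCount-below-head : ∀ d {v c xs ys a b} → Descending (suc v) xs → Descending (suc c) ys →
  pairCount (suc d) (v ∷ xs) (c ∷ ys) a b ≢ 0 → a ≤ v × b ≤ c
pairCount-below-head d dxs dys ne =
  let a<v+1 , b<c+1 = pairCount-support (suc d) (≤-refl ∷ dxs) (≤-refl ∷ dys) ne
  in s≤s⁻¹ a<v+1 , s≤s⁻¹ b<c+1

Comparable : ℕ → ℕ → ℕ → ℕ → Set
Comparable a b a′ b′ = (a ≤ a′ × b ≤ b′) ⊎ (a′ ≤ a × b′ ≤ b)

pairCount-comparable : ∀ d {m m′ xs ys} → Descending m xs → Descending m′ ys → ∀ {a b a′ b′} →
  pairCount d xs ys a b ≢ 0 → pairCount d xs ys a′ b′ ≢ 0 → Comparable a b a′ b′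
pairCount-comparable zero _ _ ne _ = ⊥-elim (ne refl)
pairCount-comparable (suc d) {ys = ys} [] _ {a} {b} ne _ = ⊥-elim (ne (pairCount-[]ˡ (suc d) ys a b))
pairCount-comparable (suc d) {xs = xs} (_ ∷ _) [] {a} {b} ne _ = ⊥-elim (ne (pairCount-[]ʳ (suc d) xs a b))
pairCount-comparable (suc d) {xs = v ∷ xs} {c ∷ ys} (_ ∷ dxs) (_ ∷ dys) {a} {b} {a′} {b′} ne ne′
  with pairCount-∷⁻ d v c xs ys a b ne | pairCount-∷⁻ d v c xs ys a′ b′ ne′
... | inj₁ (refl , refl) | _                  = inj₂ (pairCount-below-head d dxs dys ne′)
... | inj₂ _             | inj₁ (refl , refl) = inj₁ (pairCount-below-head d dxs dys ne)
... | inj₂ tail≢0        | inj₂ tail≢0′       = pairCount-comparable d dxs dys tail≢0 tail≢0′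

gridSum : ℕ → (ℕ → ℕ → ℕ) → ℕ
gridSum n g = ∑< n (λ a → ∑< n (g a))

gridSum-+ : ∀ n g h → gridSum n (λ a b → g a b + h a b) ≡ gridSum n g + gridSum n h
gridSum-+ n g h = trans (∑<-cong n (λ a _ → ∑<-+ n (g a) (h a))) (∑<-+ n _ _)

gridSum-δδ : ∀ n {a c} → a < n → c < n → gridSum n (λ a′ b′ → δ a a′ * δ c b′) ≡ 1
gridSum-δδ n {a} {c} a<n c<n = begin
  ∑< n (λ a′ → ∑< n (λ b′ → δ a a′ * δ c b′)) ≡⟨ ∑<-cong n (λ a′ _ → ∑<-*ˡ n (δ a a′) (δ c)) ⟩
  ∑< n (λ a′ → δ a a′ * ∑< n (δ c))          ≡⟨ ∑<-*ʳ n (∑< n (δ c)) (δ a) ⟩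
  ∑< n (δ a) * ∑< n (δ c)                    ≡⟨ cong₂ _*_ (∑<-δ n a a<n) (∑<-δ n c c<n) ⟩
  1                                           ∎

pairCount-total : ∀ n d {xs ys} → Descending n xs → Descending n ys → length xs ≡ d → length ys ≡ d →
  gridSum n (pairCount d xs ys) ≡ d
pairCount-total n zero    _ _ _ _ = ∑<-zero n _ (λ _ _ → ∑<-zero n _ (λ _ _ → refl))
pairCount-total n (suc d) {v ∷ xs} {c ∷ ys} (v<n ∷ dxs) (c<n ∷ dys) len len′ = begin
  gridSum n (pairCount (suc d) (v ∷ xs) (c ∷ ys))
    ≡⟨ gridSum-+ n (λ a b → δ v a * δ c b) (pairCount d xs ys) ⟩
  gridSum n (λ a b → δ v a * δ c b) + gridSum n (pairCount d xs ys)
    ≡⟨ cong₂ _+_ (gridSum-δδ n v<n c<n)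
                 (pairCount-total n d (Descending-weaken v<n dxs) (Descending-weaken c<n dys)
                                  (suc-injective len) (suc-injective len′)) ⟩
  suc d ∎

pairCount-injective : ∀ d {m m′ xs ys xs′ ys′} →
  Descending m xs → Descending m′ ys → Descending m xs′ → Descending m′ ys′ →
  length xs ≡ d → length ys ≡ d → length xs′ ≡ d → length ys′ ≡ d →
  (∀ {a b} → a < m → b < m′ → pairCount d xs ys a b ≡ pairCount d xs′ ys′ a b) → xs ≡ xs′ × ys ≡ ys′
pairCount-injective zero {xs = []} {[]} {[]} {[]} _ _ _ _ _ _ _ _ _ = refl , refl
pairCount-injective (suc d) {xs = v ∷ xs} {c ∷ ys} {v′ ∷ xs′} {c′ ∷ ys′}
  (v<m ∷ dxs) (c<m′ ∷ dys) (v′<m ∷ dxs′) (c′<m′ ∷ dys′) len₁ len₂ len₃ len₄ agree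
  with pairCount-below-head d dxs′ dys′ (λ z → pairCount-∷-head d v c xs ys (trans (agree v<m c<m′) z))
     | pairCount-below-head d dxs dys (λ z → pairCount-∷-head d v′ c′ xs′ ys′ (trans (sym (agree v′<m c′<m′)) z))
... | v≤v′ , c≤c′ | v′≤v , c′≤c with ≤-antisym v≤v′ v′≤v | ≤-antisym c≤c′ c′≤c
... | refl | refl =
  let xs≡ , ys≡ = pairCount-injective d dxs dys dxs′ dys′
                    (suc-injective len₁) (suc-injective len₂) (suc-injective len₃) (suc-injective len₄)
                    (λ {a} {b} a<v+1 b<c+1 → +-cancelˡ-≡ (δ v a * δ c b) _ _
                                               (agree (<-≤-trans a<v+1 v<m) (<-≤-trans b<c+1 c<m′)))
  in cong (v ∷_) xs≡ , cong (c ∷_) ys≡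

IsChain : ℕ → (ℕ → ℕ → ℕ) → Set
IsChain n g = ∀ {a b a′ b′} → a < n → b < n → a′ < n → b′ < n →
  g a b ≢ 0 → g a′ b′ ≢ 0 → Comparable a b a′ b′

chain-maximum : ∀ n g → IsChain n g → gridSum n g ≢ 0 →
  ∃[ a ] ∃[ c ] (a < n × c < n × g a c ≢ 0 ×
    (∀ {a′ b′} → a′ < n → b′ < n → g a′ b′ ≢ 0 → a′ ≤ a × b′ ≤ c))
chain-maximum n g chain total≢0
  with a , a<n , row≢0 , lastRow ← ∑<-lastNonzero n (λ a → ∑< n (g a)) total≢0
  with c , c<n , gac≢0 , lastCol ← ∑<-lastNonzero n (g a) row≢0
  = a , c , a<n , c<n , gac≢0 , maximum
  where
  maximum : ∀ {a′ b′} → a′ < n → b′ < n → g a′ b′ ≢ 0 → a′ ≤ a × b′ ≤ c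
  maximum {a′} {b′} a′<n b′<n ne with chain a<n c<n a′<n b′<n gac≢0 ne
  ... | inj₂ below = below
  ... | inj₁ (a≤a′ , _) with ≤-antisym a≤a′ (lastRow a′ a′<n (∑<-≢0 n (g a′) b′<n ne))
  ... | refl = ≤-refl , lastCol b′ b′<n ne

δδ≤ : ∀ (g : ℕ → ℕ → ℕ) {a c} → g a c ≢ 0 → ∀ a′ b′ → δ a a′ * δ c b′ ≤ g a′ b′
δδ≤ g {a} {c} ne a′ b′ with a ≟ a′ | c ≟ b′
... | yes refl | yes refl = subst (_≤ g a c) (sym (cong₂ _*_ (δ-refl a) (δ-refl c))) (n≢0⇒n>0 ne)
... | no a≢a′  | _        = subst (_≤ g a′ b′) (sym (cong (_* δ c b′) (δ-≢ a a′ a≢a′))) z≤n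
... | yes _    | no c≢b′  =
  subst (_≤ g a′ b′) (sym (trans (cong (δ a a′ *_) (δ-≢ c b′ c≢b′)) (*-zeroʳ (δ a a′)))) z≤n

-- Peel off the largest support point, one unit at a time; the rest is a chain below it.
chain-decomposition : ∀ n d g {m m′} → IsChain n g →
  (∀ {a b} → a < n → b < n → g a b ≢ 0 → a < m × b < m′) → gridSum n g ≡ d →
  ∃[ xs ] ∃[ ys ] (Descending m xs × Descending m′ ys × length xs ≡ d × length ys ≡ d ×
    (∀ {a b} → a < n → b < n → g a b ≡ pairCount d xs ys a b))
chain-decomposition n zero g chain bound total =
  [] , [] , [] , [] , refl , refl ,
  λ {a} {b} a<n b<n → ∑<-≡0⇒≡0 n (g a) (∑<-≡0⇒≡0 n _ total a a<n) b b<n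
chain-decomposition n (suc d) g {m} {m′} chain bound total =
  peel (chain-maximum n g chain (λ total≡0 → 0≢1+n (trans (sym total≡0) total)))
  where
  peel : ∃[ a ] ∃[ c ] (a < n × c < n × g a c ≢ 0 ×
           (∀ {a′ b′} → a′ < n → b′ < n → g a′ b′ ≢ 0 → a′ ≤ a × b′ ≤ c)) →
         ∃[ xs ] ∃[ ys ] (Descending m xs × Descending m′ ys × length xs ≡ suc d × length ys ≡ suc d ×
           (∀ {a b} → a < n → b < n → g a b ≡ pairCount (suc d) xs ys a b))
  peel (a , c , a<n , c<n , gac≢0 , maximum) =
    let xs , ys , dxs , dys , len , len′ , g′≡ = chain-decomposition n d g′ chain′ bound′ total′
        a<m , c<m′ = bound a<n c<n gac≢0
    in a ∷ xs , c ∷ ys , a<m ∷ dxs , c<m′ ∷ dys , cong suc len , cong suc len′ ,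
       λ {a′} {b′} a′<n b′<n → trans (split a′ b′) (cong (δ a a′ * δ c b′ +_) (g′≡ a′<n b′<n))
    where
    g′ : ℕ → ℕ → ℕ
    g′ a′ b′ = g a′ b′ ∸ δ a a′ * δ c b′
    split : ∀ a′ b′ → g a′ b′ ≡ δ a a′ * δ c b′ + g′ a′ b′
    split a′ b′ = sym (m+[n∸m]≡n (δδ≤ g gac≢0 a′ b′))
    g′≢0⇒g≢0 : ∀ {a′ b′} → g′ a′ b′ ≢ 0 → g a′ b′ ≢ 0
    g′≢0⇒g≢0 {a′} {b′} ne g≡0 = ne (trans (cong (_∸ δ a a′ * δ c b′) g≡0) (0∸n≡0 (δ a a′ * δ c b′)))
    chain′ : IsChain n g′
    chain′ p q r s ne ne′ = chain p q r s (g′≢0⇒g≢0 ne) (g′≢0⇒g≢0 ne′)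
    bound′ : ∀ {a′ b′} → a′ < n → b′ < n → g′ a′ b′ ≢ 0 → a′ < suc a × b′ < suc c
    bound′ a′<n b′<n ne = let a′≤a , b′≤c = maximum a′<n b′<n (g′≢0⇒g≢0 ne) in s≤s a′≤a , s≤s b′≤c
    total′ : gridSum n g′ ≡ d
    total′ = suc-injective (begin
      suc (gridSum n g′)                                  ≡⟨ cong (_+ gridSum n g′) (sym (gridSum-δδ n a<n c<n)) ⟩
      gridSum n (λ a′ b′ → δ a a′ * δ c b′) + gridSum n g′ ≡⟨ sym (gridSum-+ n _ g′) ⟩
      gridSum n (λ a′ b′ → δ a a′ * δ c b′ + g′ a′ b′)
        ≡⟨ ∑<-cong n (λ a′ _ → ∑<-cong n (λ b′ _ → sym (split a′ b′))) ⟩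
      gridSum n g                                          ≡⟨ total ⟩
      suc d                                                ∎)

-- Matrices as grids

fromGrid : ∀ {n} → (ℕ → ℕ → ℕ) → Matrix n
fromGrid g = tabulate (λ i → tabulate (λ j → g (toℕ i) (toℕ j)))

entry-fromGrid : ∀ {n} g (i j : Fin n) → entry (fromGrid g) i j ≡ g (toℕ i) (toℕ j)
entry-fromGrid g i j =
  trans (cong (λ row → lookup row j) (lookup∘tabulate _ i)) (lookup∘tabulate (λ j → g (toℕ i) (toℕ j)) j)

Matrix-ext : ∀ {n} {M N : Matrix n} → (∀ i j → entry M i j ≡ entry N i j) → M ≡ N
Matrix-ext {M = M} {N} eq = begin
  M                                              ≡⟨ sym (tabulate∘lookup M) ⟩
  tabulate (lookup M)                            ≡⟨ tabulate-cong (λ i → sym (tabulate∘lookup (lookup M i))) ⟩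
  tabulate (λ i → tabulate (lookup (lookup M i))) ≡⟨ tabulate-cong (λ i → tabulate-cong (eq i)) ⟩
  tabulate (λ i → tabulate (lookup (lookup N i))) ≡⟨ tabulate-cong (λ i → tabulate∘lookup (lookup N i)) ⟩
  tabulate (lookup N)                            ≡⟨ tabulate∘lookup N ⟩
  N                                              ∎

lookupOr : ∀ {A : Set} {k} → A → Vec A k → ℕ → A
lookupOr default Vec.[]       _       = default
lookupOr default (x Vec.∷ xs) zero    = x
lookupOr default (x Vec.∷ xs) (suc a) = lookupOr default xs a

lookupOr-toℕ : ∀ {A : Set} {k} default (xs : Vec A k) i → lookupOr default xs (toℕ i) ≡ lookup xs i
lookupOr-toℕ default (x Vec.∷ xs) Fin.zero    = refl
lookupOr-toℕ default (x Vec.∷ xs) (Fin.suc i) = lookupOr-toℕ default xs i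

-- Indices outside [0, n) read as 0.
toGrid : ∀ {n} → Matrix n → ℕ → ℕ → ℕ
toGrid {n} M a b = lookupOr 0 (lookupOr (replicate n 0) M a) b

toGrid-toℕ : ∀ {n} (M : Matrix n) i j → toGrid M (toℕ i) (toℕ j) ≡ entry M i j
toGrid-toℕ M i j = trans (cong (λ row → lookupOr 0 row (toℕ j)) (lookupOr-toℕ _ M i)) (lookupOr-toℕ 0 (lookup M i) j)

sum-allFin : ∀ m (G : ℕ → ℕ) → sum (map (λ i → G (toℕ i)) (allFin m)) ≡ ∑< m G
sum-allFin m G = trans (cong sum (map-tabulate {n = m} (λ i → i) (λ i → G (toℕ i)))) (sum-tabulate m G)
  where
  sum-tabulate : ∀ m (G : ℕ → ℕ) → sum (List.tabulate {n = m} (λ i → G (toℕ i))) ≡ ∑< m G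
  sum-tabulate zero    G = refl
  sum-tabulate (suc m) G = cong (G 0 +_) (sum-tabulate m (λ k → G (suc k)))

totalSum-grid : ∀ {n} (M : Matrix n) g → (∀ i j → entry M i j ≡ g (toℕ i) (toℕ j)) → totalSum M ≡ gridSum n g
totalSum-grid {n} M g eq = begin
  sum (map (λ i → sum (map (λ j → entry M i j) (allFin n))) (allFin n))
    ≡⟨ cong sum (map-cong (λ i → trans (cong sum (map-cong (eq i) (allFin n)))
                                                            (sum-allFin n (g (toℕ i)))) (allFin n)) ⟩
  sum (map (λ i → ∑< n (g (toℕ i))) (allFin n))
    ≡⟨ sum-allFin n (λ a → ∑< n (g a)) ⟩
  gridSum n g ∎

comparable-cong : ∀ {a b a′ b′ x y x′ y′} → x ≡ a → y ≡ b → x′ ≡ a′ → y′ ≡ b′ →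
  Comparable x y x′ y′ → Comparable a b a′ b′
comparable-cong refl refl refl refl c = c

isChain⇒widthOne : ∀ {n} g → IsChain n g → WidthOne (fromGrid {n} g)
isChain⇒widthOne g chain i j i′ j′ s s′ =
  chain (toℕ<n i) (toℕ<n j) (toℕ<n i′) (toℕ<n j′)
        (λ z → s (trans (entry-fromGrid g i j) z)) (λ z → s′ (trans (entry-fromGrid g i′ j′) z))

widthOne⇒isChain : ∀ {n} (M : Matrix n) → WidthOne M → IsChain n (toGrid M)
widthOne⇒isChain M wo a<n b<n a′<n b′<n ne ne′ =
  comparable-cong (toℕ-fromℕ< a<n) (toℕ-fromℕ< b<n) (toℕ-fromℕ< a′<n) (toℕ-fromℕ< b′<n)
    (wo _ _ _ _ (support a<n b<n ne) (support a′<n b′<n ne′))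
  where
  support : ∀ {a b} (a<n : a < _) (b<n : b < _) → toGrid M a b ≢ 0 → InSupport M (fromℕ< a<n) (fromℕ< b<n)
  support {a} {b} a<n b<n ne z = ne (trans (cong₂ (toGrid M) (sym (toℕ-fromℕ< a<n)) (sym (toℕ-fromℕ< b<n)))
                                           (trans (toGrid-toℕ M _ _) z))

-- The enumeration of width-one matrices

matrixOf : ∀ {n} → ℕ → List ℕ × List ℕ → Matrix n
matrixOf d (xs , ys) = fromGrid (pairCount d xs ys)

widthOneMatrices : ℕ → (n : ℕ) → List (Matrix n)
widthOneMatrices d n = map (matrixOf d) (cartesianProduct (descending d n) (descending d n))

entry-matrixOf : ∀ {n} d xs ys {a b} (a<n : a < n) (b<n : b < n) →
  entry (matrixOf d (xs , ys)) (fromℕ< a<n) (fromℕ< b<n) ≡ pairCount d xs ys a b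
entry-matrixOf d xs ys a<n b<n =
  trans (entry-fromGrid (pairCount d xs ys) _ _) (cong₂ (pairCount d xs ys) (toℕ-fromℕ< a<n) (toℕ-fromℕ< b<n))

matrixOf-injective : ∀ d n {p p′} →
  p ∈ cartesianProduct (descending d n) (descending d n) →
  p′ ∈ cartesianProduct (descending d n) (descending d n) →
  matrixOf {n} d p ≡ matrixOf d p′ → p ≡ p′
matrixOf-injective d n {xs , ys} {xs′ , ys′} p∈ p′∈ eq
  with xs∈ , ys∈ ← ∈-cartesianProduct⁻ (descending d n) (descending d n) p∈
     | xs′∈ , ys′∈ ← ∈-cartesianProduct⁻ (descending d n) (descending d n) p′∈
  with dxs , lxs ← ∈-descending⁻ d n xs∈ | dys , lys ← ∈-descending⁻ d n ys∈
     | dxs′ , lxs′ ← ∈-descending⁻ d n xs′∈ | dys′ , lys′ ← ∈-descending⁻ d n ys′∈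
  with refl , refl ← pairCount-injective d dxs dys dxs′ dys′ lxs lys lxs′ lys′
    (λ a<n b<n → trans (sym (entry-matrixOf d xs ys a<n b<n))
                       (trans (cong (λ M → entry M (fromℕ< a<n) (fromℕ< b<n)) eq) (entry-matrixOf d xs′ ys′ a<n b<n)))
  = refl

widthOneMatrices-unique : ∀ d n → Unique (widthOneMatrices d n)
widthOneMatrices-unique d n =
  map⁺-onMembers (matrixOf d) (Unique.cartesianProduct⁺ (descending-unique d n) (descending-unique d n))
                 (matrixOf-injective d n)

∈-widthOneMatrices⇔ : ∀ d n (M : Matrix n) → M ∈ widthOneMatrices d n ⇔ InT d n M
∈-widthOneMatrices⇔ d n M = mk⇔ to from
  where
  to : M ∈ widthOneMatrices d n → InT d n M
  to M∈ with (xs , ys) , p∈ , refl ← ∈-map⁻ (matrixOf d) M∈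
        with xs∈ , ys∈ ← ∈-cartesianProduct⁻ (descending d n) (descending d n) p∈
        with dxs , lxs ← ∈-descending⁻ d n xs∈ | dys , lys ← ∈-descending⁻ d n ys∈ =
    isChain⇒widthOne (pairCount d xs ys) (λ _ _ _ _ → pairCount-comparable d dxs dys) ,
    trans (totalSum-grid M (pairCount d xs ys) (entry-fromGrid (pairCount d xs ys)))
          (pairCount-total n d dxs dys lxs lys)
  from : InT d n M → M ∈ widthOneMatrices d n
  from (widthOne , total)
    with xs , ys , dxs , dys , lxs , lys , grid≡ ←
      chain-decomposition n d (toGrid M) (widthOne⇒isChain M widthOne) (λ a<n b<n _ → a<n , b<n)
        (trans (sym (totalSum-grid M (toGrid M) (λ i j → sym (toGrid-toℕ M i j)))) total) =
    subst (_∈ widthOneMatrices d n) (sym M≡)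
      (∈-map⁺ (matrixOf d) (∈-cartesianProduct⁺ (subst (λ l → xs ∈ descending l n) lxs (∈-descending⁺ dxs))
                                                (subst (λ l → ys ∈ descending l n) lys (∈-descending⁺ dys))))
    where
    M≡ : M ≡ matrixOf d (xs , ys)
    M≡ = Matrix-ext λ i j → begin
      entry M i j                               ≡⟨ sym (toGrid-toℕ M i j) ⟩
      toGrid M (toℕ i) (toℕ j)                  ≡⟨ grid≡ (toℕ<n i) (toℕ<n j) ⟩
      pairCount d xs ys (toℕ i) (toℕ j)         ≡⟨ sym (entry-fromGrid (pairCount d xs ys) i j) ⟩
      entry (matrixOf d (xs , ys)) i j          ∎

sum-entry-widthOneMatrices : ∀ d n (i j : Fin n) →
  sum (map (λ M → entry M i j) (widthOneMatrices d n)) ≡ ∑< d (λ t → countAt d n t (toℕ i) * countAt d n t (toℕ j))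
sum-entry-widthOneMatrices d n i j = begin
  sumMap (λ M → entry M i j) (map (matrixOf d) (cartesianProduct W W))
    ≡⟨ sumMap-map (λ M → entry M i j) (matrixOf d) (cartesianProduct W W) ⟩
  sumMap (λ p → entry (matrixOf d p) i j) (cartesianProduct W W)
    ≡⟨ sumMap-cartesianProduct (λ p → entry (matrixOf d p) i j) W W ⟩
  sumMap (λ xs → sumMap (λ ys → entry (matrixOf d (xs , ys)) i j) W) W
    ≡⟨ sumMap-cong W (λ xs → sumMap-cong W (λ ys → entry-fromGrid (pairCount d xs ys) i j)) ⟩
  sumMap (λ xs → sumMap (λ ys → pairCount d xs ys a b) W) W
    ≡⟨ sumMap-cong W (λ xs → sumMap-∑< d (λ ys t → δ-at xs t a * δ-at ys t b) W) ⟩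
  sumMap (λ xs → ∑< d (λ t → sumMap (λ ys → δ-at xs t a * δ-at ys t b) W)) W
    ≡⟨ sumMap-cong W (λ xs → ∑<-cong d (λ t _ → sumMap-*ˡ (δ-at xs t a) (λ ys → δ-at ys t b) W)) ⟩
  sumMap (λ xs → ∑< d (λ t → δ-at xs t a * countAt d n t b)) W
    ≡⟨ sumMap-∑< d (λ xs t → δ-at xs t a * countAt d n t b) W ⟩
  ∑< d (λ t → sumMap (λ xs → δ-at xs t a * countAt d n t b) W)
    ≡⟨ ∑<-cong d (λ t _ → sumMap-*ʳ (countAt d n t b) (λ xs → δ-at xs t a) W) ⟩
  ∑< d (λ t → countAt d n t a * countAt d n t b) ∎
  where
  W = descending d n
  a = toℕ i
  b = toℕ j

-- Matching the closed formula

countAt-products : ∀ D n i j q q′ → suc (i + q) ≡ n → suc (j + q′) ≡ n →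
  ∑< (suc D) (λ t → countAt (suc D) n t i * countAt (suc D) n t j) ≡
  ((negBinom i ⊙ negBinom j) ⋆ (negBinom q ⊙ negBinom q′)) D
countAt-products D n i j q q′ i+q+1≡n j+q′+1≡n = begin
  ∑< (suc D) (λ t → countAt (suc D) n t i * countAt (suc D) n t j)
    ≡⟨ ∑<-antidiagonal D (λ s t → countAt (suc s) n t i * countAt (suc s) n t j) ⟩
  antidiagonal D (λ t u → countAt (suc (t + u)) n t i * countAt (suc (t + u)) n t j)
    ≡⟨ antidiagonal-cong D (λ t u → cong₂ _*_ (closed i q i+q+1≡n t u) (closed j q′ j+q′+1≡n t u)) ⟩
  antidiagonal D (λ t u → negBinom q t * negBinom i u * (negBinom q′ t * negBinom j u))
    ≡⟨ antidiagonal-comm D _ ⟩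
  antidiagonal D (λ u t → negBinom q t * negBinom i u * (negBinom q′ t * negBinom j u))
    ≡⟨ antidiagonal-cong D (λ u t → regroup (negBinom q t) (negBinom i u) (negBinom q′ t) (negBinom j u)) ⟩
  antidiagonal D (λ u t → negBinom i u * negBinom j u * (negBinom q t * negBinom q′ t)) ∎
  where
  closed : ∀ i q → suc (i + q) ≡ n → ∀ t u → countAt (suc (t + u)) n t i ≡ negBinom q t * negBinom i u
  closed i q refl t u = countAt-closed t u i q
  regroup : ∀ a b c e → a * b * (c * e) ≡ b * e * (a * c)
  regroup = solve 4 (λ a b c e → a :* b :* (c :* e) := b :* e :* (a :* c)) refl

⊙⋆⊙-coefficient : ∀ i j q q′ k →
  (binom i ⊙ binom j ⋆ binom q ⊙ binom q′) k ≡ Σ<[ suc k ] (λ l → (i C l) * (j C l) * (q C (k ∸ l)) * (q′ C (k ∸ l)))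
⊙⋆⊙-coefficient i j q q′ k = begin
  antidiagonal k (λ l m → (i C l) * (j C l) * ((q C m) * (q′ C m)))
    ≡⟨ antidiagonal-cong k (λ l m → sym (*-assoc ((i C l) * (j C l)) (q C m) (q′ C m))) ⟩
  antidiagonal k (λ l m → (i C l) * (j C l) * (q C m) * (q′ C m))
    ≡⟨ antidiagonal-∑< k _ ⟩
  ∑< (suc k) (λ l → (i C l) * (j C l) * (q C (k ∸ l)) * (q′ C (k ∸ l)))
    ≡⟨ sym (sumMap-upTo _ (suc k)) ⟩
  Σ<[ suc k ] (λ l → (i C l) * (j C l) * (q C (k ∸ l)) * (q′ C (k ∸ l))) ∎

negBinom-reindex : ∀ N D k → k ≤ D → negBinom N (D ∸ k) ≡ (suc N + suc D ∸ k ∸ 2) C N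
negBinom-reindex N D k k≤D = cong (_C N) (sym (begin
  suc N + suc D ∸ k ∸ 2     ≡⟨ cong (_∸ 2) (+-∸-assoc (suc N) (m≤n⇒m≤1+n k≤D)) ⟩
  suc N + (suc D ∸ k) ∸ 2   ≡⟨ cong (λ x → suc N + x ∸ 2) (+-∸-assoc 1 k≤D) ⟩
  N + suc (D ∸ k) ∸ 1       ≡⟨ cong (_∸ 1) (+-suc N (D ∸ k)) ⟩
  N + (D ∸ k)               ∎))

series≡formula : ∀ n D i j q q′ → suc (i + q) ≡ n → suc (j + q′) ≡ n →
  ((binom i ⊙ binom j ⋆ binom q ⊙ binom q′) ⋆ negBinom (suc (i + j + (q + q′)))) D ≡
  formula (suc D) n (suc i) (suc j)
series≡formula n D i j q q′ i+q+1≡n j+q′+1≡n = begin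
  (G ⋆ negBinom N) D                              ≡⟨ antidiagonal-∑< D (λ k m → G k * negBinom N m) ⟩
  ∑< (suc D) (λ k → G k * negBinom N (D ∸ k))      ≡⟨ ∑<-cong (suc D) (λ k k<D+1 → summand k (s≤s⁻¹ k<D+1)) ⟩
  ∑< (suc D) term                                  ≡⟨ ∑<-⊓ (suc D) n term term-vanishes ⟩
  ∑< (suc D ⊓ n) term                              ≡⟨ sym (sumMap-upTo term (suc D ⊓ n)) ⟩
  formula (suc D) n (suc i) (suc j)                ∎
  where
  G = binom i ⊙ binom j ⋆ binom q ⊙ binom q′
  N = suc (i + j + (q + q′))
  coefficient inner term : ℕ → ℕ
  coefficient k = (2 * n + suc D ∸ k ∸ 2) C (2 * n ∸ 1)
  inner k = Σ<[ suc k ] (λ l → (i C l) * (j C l) * ((n ∸ suc i) C (k ∸ l)) * ((n ∸ suc j) C (k ∸ l)))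
  term k = coefficient k * inner k
  n∸[1+i]≡q : ∀ {i q} → suc (i + q) ≡ n → n ∸ suc i ≡ q
  n∸[1+i]≡q {i} {q} refl = m+n∸m≡n i q
  inner≡G : ∀ k → inner k ≡ G k
  inner≡G k = trans (cong₂ (λ x y → Σ<[ suc k ] (λ l → (i C l) * (j C l) * (x C (k ∸ l)) * (y C (k ∸ l))))
                           (n∸[1+i]≡q i+q+1≡n) (n∸[1+i]≡q j+q′+1≡n))
                    (sym (⊙⋆⊙-coefficient i j q q′ k))
  2n≡1+N : 2 * n ≡ suc N
  2n≡1+N = trans (cong₂ (λ x y → x + (y + 0)) (sym i+q+1≡n) (sym j+q′+1≡n))
                 (solve 4 (λ i j q q′ → con 1 :+ (i :+ q) :+ ((con 1 :+ (j :+ q′)) :+ con 0)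
                                       := con 1 :+ (con 1 :+ (i :+ j :+ (q :+ q′)))) refl i j q q′)
  summand : ∀ k → k ≤ D → G k * negBinom N (D ∸ k) ≡ term k
  summand k k≤D = trans (*-comm (G k) _) (cong₂ _*_
    (trans (negBinom-reindex N D k k≤D) (cong₂ (λ x y → (x + suc D ∸ k ∸ 2) C (y ∸ 1)) (sym 2n≡1+N) (sym 2n≡1+N)))
    (sym (inner≡G k)))
  term-vanishes : ∀ k → n ≤ k → term k ≡ 0
  term-vanishes k n≤k = trans (cong (coefficient k *_) (trans (inner≡G k)
                                (⊙⋆⊙-vanishes i q (binom j) (binom q′) k (subst (_≤ k) (sym i+q+1≡n) n≤k))))
                              (*-zeroʳ (coefficient k))

sum-entry≡formula : ∀ n D (i j : Fin n) →
  sum (map (λ M → entry M i j) (widthOneMatrices (suc D) n)) ≡ formula (suc D) n (suc (toℕ i)) (suc (toℕ j))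
sum-entry≡formula n D i j = begin
  sum (map (λ M → entry M i j) (widthOneMatrices (suc D) n))
    ≡⟨ sum-entry-widthOneMatrices (suc D) n i j ⟩
  ∑< (suc D) (λ t → countAt (suc D) n t a * countAt (suc D) n t b)
    ≡⟨ countAt-products D n a b q q′ a+q+1≡n b+q′+1≡n ⟩
  ((negBinom a ⊙ negBinom b) ⋆ (negBinom q ⊙ negBinom q′)) D
    ≡⟨ negBinomProd-⋆ a b q q′ D ⟩
  ((binom a ⊙ binom b ⋆ binom q ⊙ binom q′) ⋆ negBinom (suc (a + b + (q + q′)))) D
    ≡⟨ series≡formula n D a b q q′ a+q+1≡n b+q′+1≡n ⟩
  formula (suc D) n (suc a) (suc b) ∎
  where
  a = toℕ i
  b = toℕ j
  q = n ∸ suc a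
  q′ = n ∸ suc b
  a+q+1≡n : suc (a + q) ≡ n
  a+q+1≡n = m+[n∸m]≡n (toℕ<n i)
  b+q′+1≡n : suc (b + q′) ≡ n
  b+q′+1≡n = m+[n∸m]≡n (toℕ<n j)

theorem5p1 : (n d : ℕ) → 1 ≤ n → 1 ≤ d →
    ∃[ L ] (Unique L × (∀ (M : Matrix n) → (M ∈ L) ⇔ InT d n M) ×
      (∀ (i j : Fin n) →
        sum (map (λ M → entry M i j) L) ≡ formula d n (suc (toℕ i)) (suc (toℕ j))))
theorem5p1 n zero    _ ()
theorem5p1 n (suc D) _ _ =
  widthOneMatrices (suc D) n , widthOneMatrices-unique (suc D) n , ∈-widthOneMatrices⇔ (suc D) n ,
  sum-entry≡formula n D
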